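{- Let $G$ be a finite abelian group with identity $1$, let $S$ be an inverse-closed subset of $G\setminus\{1\}$ with $|S|\ge 3$, let $s\in S$ be such that $H=\langle S\setminus\{s,s^{ -1}\}\rangle \neq G$, and let $\Gamma=\mathrm{Cay}(G;S)$. Suppose $[G:H]=2$ and the order of $s$ is at least $6$. If $\Gamma$ is distance-regular with intersection number $a_1=0$, then $\Gamma$ is isomorphic to $K_{6,6}-6K_2$, the complete bipartite graph $K_{6,6}$ with a perfect matching removed.
   Context: The Cayley graph $\mathrm{Cay}(G;S)$ has vertex set $G$, with $g$ adjacent to $h$ iff $h=gs'$ for some $s'\in S$. A connected graph $\Gamma$ with distance $\partial$ is distance-regular if for each $i$ up to the diameter the numbers $c_i(x,y)=|N_{i-1}(x)\cap N(y)|$, $a_i(x,y)=|N_i(x)\cap N(y)|$, $b_i(x,y)=|N_{i+1}(x)\cap N(y)|$ depend only on $i=\partial(x,y)$; their common values are the intersection numbers $c_i,a_i,b_i$. Here $N_j(x)$ is the set of vertices at distance $j$ from $x$ and $N(y)=N_1(y)$. -}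

module Defs where

open import Level using (0ℓ)
open import Data.Nat using (ℕ; zero; suc; _≤_; _<_)
open import Data.Fin using (Fin)
open import Data.Fin.Subset using (Subset; _∈_)
open import Data.Bool using (Bool; true; false; _xor_)
open import Data.Product using (Σ; ∃; _×_; _,_)
open import Data.List using (List; length)
import Data.List.Membership.Propositional as LM
open import Data.List.Relation.Unary.Unique.Propositional using (Unique)
open import Relation.Binary.PropositionalEquality using (_≡_; _≢_)
open import Relation.Nullary using (¬_)
open import Algebra.Structures using (IsAbelianGroup)
open import Function.Bundles using (_↔_; Inverse)

-- Finite abelian groups, realised on the carrier Fin n
-- (every finite group is isomorphic to one of this form).

record FiniteAbelianGroup : Set where
  field
    n       : ℕ
    _∙_     : Fin n → Fin n → Fin n
    ε       : Fin n
    _⁻¹     : Fin n → Fin n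
    isAbelianGroup : IsAbelianGroup _≡_ _∙_ ε _⁻¹
  infixl 7 _∙_
  infix  8 _⁻¹

module _ (G : FiniteAbelianGroup) where
  open FiniteAbelianGroup G

  pow : Fin n → ℕ → Fin n
  pow g zero    = ε
  pow g (suc m) = g ∙ pow g m

  HasOrder : Fin n → ℕ → Set
  HasOrder g m = (0 < m) × (pow g m ≡ ε) × (∀ k → 0 < k → k < m → pow g k ≢ ε)

  data Generated (T : Fin n → Set) : Fin n → Set where
    gen  : ∀ {x} → T x → Generated T x
    one  : Generated T ε
    mul  : ∀ {x y} → Generated T x → Generated T y → Generated T (x ∙ y)
    inv  : ∀ {x} → Generated T x → Generated T (x ⁻¹)

  -- [G : H] = k : there are k cosets g₁H, …, g_kH, i.e. a transversal
  -- (g₁,…,g_k) such that every x lies in exactly one coset g_i H.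
  HasIndex : (H : Fin n → Set) → ℕ → Set
  HasIndex H k = Σ (Fin k → Fin n) λ g →
      (∀ x → ∃ λ i → H ((g i) ⁻¹ ∙ x))
    × (∀ x i j → H ((g i) ⁻¹ ∙ x) → H ((g j) ⁻¹ ∙ x) → i ≡ j)

record Graph : Set₁ where
  field
    V   : Set
    Adj : V → V → Set

Cay : (G : FiniteAbelianGroup) → Subset (FiniteAbelianGroup.n G) → Graph
Cay G S = record
  { V   = Fin n
  ; Adj = λ g h → ∃ λ s' → s' ∈ S × h ≡ g ∙ s'
  }
  where open FiniteAbelianGroup G

module _ (Γ : Graph) where
  open Graph Γ

  data Walk : V → V → ℕ → Set where
    here : ∀ {x} → Walk x x zero
    step : ∀ {x y z k} → Adj x y → Walk y z k → Walk x z (suc k)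

  Connected : Set
  Connected = ∀ x y → ∃ λ k → Walk x y k

  Dist : V → V → ℕ → Set
  Dist x y d = Walk x y d × (∀ k → Walk x y k → d ≤ k)

  Card : (V → Set) → ℕ → Set
  Card P c = Σ (List V) λ zs →
    Unique zs × length zs ≡ c × (∀ z → (P z → z LM.∈ zs) × (z LM.∈ zs → P z))

  -- c_i, a_i, b_i depend only on i = ∂(x,y); c is used for i ≥ 1 only
  -- (the intersection of N_{i-1}(x) with N(y)).
  record DistanceRegular : Set where
    field
      connected : Connected
      c a b     : ℕ → ℕ
      c-reg : ∀ x y i → Dist x y (suc i) →
                Card (λ z → Dist x z i × Adj y z) (c (suc i))
      a-reg : ∀ x y i → Dist x y i →
                Card (λ z → Dist x z i × Adj y z) (a i)
      b-reg : ∀ x y i → Dist x y i →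
                Card (λ z → Dist x z (suc i) × Adj y z) (b i)

record _≅_ (Γ Δ : Graph) : Set where
  field
    bij  : Graph.V Γ ↔ Graph.V Δ
    pres : ∀ x y → (Graph.Adj Γ x y → Graph.Adj Δ (Inverse.to bij x) (Inverse.to bij y))
                 × (Graph.Adj Δ (Inverse.to bij x) (Inverse.to bij y) → Graph.Adj Γ x y)

K66-6K2 : Graph
K66-6K2 = record
  { V   = Bool × Fin 6
  ; Adj = λ { (p , i) (q , j) → ((p xor q) ≡ true) × (i ≢ j) }
  }

module Submission where

-- Since Cay(G;S) is connected, s ∉ H; as [G : H] = 2, r = s² ∈ H, and
-- a₁ = 0 gives r ∉ S. Counting common neighbours of ε and su (u ∈ T) and of ε
-- and r, both at distance 2, shows first that rT ⊆ T, then that c₂ ≤ 4 forces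
-- T = {t, rt, r²t}. This yields r³ = 1 (so s⁶ = 1), an involution t ∈ T, and
-- S = {s, s⁻¹, t, s²t, s⁴t}. Hence (a, b) ↦ sᵃtᵇ is an isomorphism from ℤ₆ × ℤ₂
-- onto G carrying a fixed connection set of ℤ₆ × ℤ₂ onto S, and a finite
-- computation identifies that Cayley graph of ℤ₆ × ℤ₂ with K₆,₆ − 6K₂.

open import Defs
open import Level using (0ℓ)
open import Algebra.Bundles using (AbelianGroup)
import Algebra.Properties.AbelianGroup as AbelianGroupProperties
import Algebra.Solver.CommutativeMonoid as CommutativeMonoidSolver
open import Data.Bool using (Bool; true; false; _xor_)
open import Data.Bool.Properties using () renaming (_≟_ to _≟ᵇ_)
open import Data.Empty using (⊥; ⊥-elim)
open import Data.Fin using (Fin; zero; suc; toℕ; fromℕ<)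
import Data.Fin.Properties as Fin
open import Data.Fin.Properties using (all?; toℕ-fromℕ<) renaming (_≟_ to _≟ᶠ_)
open import Data.Fin.Subset using (Subset; _∈_; _∉_; ∣_∣; _∪_; ⁅_⁆; inside; outside)
open import Data.Fin.Subset.Properties using (p⊆q⇒∣p∣≤∣q∣; ∣⁅x⁆∣≡1; x∈⁅x⁆; x∈p∪q⁺; _∈?_)
open import Data.List using (List; []; _∷_; length)
open import Data.List.Properties using (length-removeAt′)
open import Data.List.Membership.Propositional using (find) renaming (_∈_ to _∈ₗ_)
open import Data.List.Relation.Unary.All as All using ([]; _∷_)
open import Data.List.Relation.Unary.AllPairs using ([]; _∷_)
open import Data.List.Relation.Unary.Any as Any using (Any; here; there; _─_; any?)
open import Data.List.Relation.Unary.Unique.Propositional using (Unique)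
open import Data.Nat using (ℕ; zero; suc; _≤_; _<_; _+_; _∸_; _*_; z≤n; s≤s; _<?_)
open import Data.Nat.DivMod using (_%_; _/_; m%n<n; m≡m%n+[m/n]*n)
open import Data.Nat.Induction using (<-rec)
open import Data.Nat.Properties using (≤-refl; ≤-trans; <⇒≤; <-irrefl; ≤⇒≯; +-suc; n≤1+n; anyUpTo?)
open import Data.Product using (_×_; _,_; ∃; proj₁; proj₂)
open import Data.Product.Properties using (≡-dec)
open import Data.Sum using (_⊎_; inj₁; inj₂)
open import Data.Vec using ([]; _∷_)
open import Function using (_∘_; _⇔_; mk⇔; Equivalence)
open import Function.Bundles using (mk↔ₛ′)
open import Function.Construct.Composition using (_↔-∘_)
open import Relation.Binary.PropositionalEquality
open import Relation.Nullary using (¬_; Dec; yes; no)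
open import Relation.Nullary.Decidable using (map′; ¬?; _×-dec_; _→-dec_; toWitness)
import Relation.Unary as U

open Graph using (V; Adj)

module _ {A : Set} where

  ∈-─ : ∀ {x z} (ys : List A) (x∈ys : x ∈ₗ ys) → z ∈ₗ ys → x ≢ z → z ∈ₗ (ys ─ x∈ys)
  ∈-─ (y ∷ ys) (here refl) (here refl) x≢z = ⊥-elim (x≢z refl)
  ∈-─ (y ∷ ys) (here _)    (there z∈ys) _   = z∈ys
  ∈-─ (y ∷ ys) (there _)   (here z≡y)   _   = here z≡y
  ∈-─ (y ∷ ys) (there x∈ys) (there z∈ys) x≢z = there (∈-─ ys x∈ys z∈ys x≢z)

  unique⊆⇒length≤ : ∀ {xs} ys → Unique xs → (∀ {z} → z ∈ₗ xs → z ∈ₗ ys) → length xs ≤ length ys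
  unique⊆⇒length≤ {[]}     ys _              _  = z≤n
  unique⊆⇒length≤ {x ∷ xs} ys (x∉xs ∷ uniq) xs⊆ys =
    subst (suc (length xs) ≤_) (sym (length-removeAt′ ys _))
      (s≤s (unique⊆⇒length≤ (ys ─ x∈ys) uniq
              (λ z∈xs → ∈-─ ys x∈ys (xs⊆ys (there z∈xs)) (All.lookup x∉xs z∈xs))))
    where x∈ys = xs⊆ys (here refl)

∣p∪q∣≤∣p∣+∣q∣ : ∀ {m} (p q : Subset m) → ∣ p ∪ q ∣ ≤ ∣ p ∣ + ∣ q ∣
∣p∪q∣≤∣p∣+∣q∣ []            []            = z≤n
∣p∪q∣≤∣p∣+∣q∣ (outside ∷ p) (outside ∷ q) = ∣p∪q∣≤∣p∣+∣q∣ p q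
∣p∪q∣≤∣p∣+∣q∣ (outside ∷ p) (inside ∷ q)  =
  subst (suc ∣ p ∪ q ∣ ≤_) (sym (+-suc ∣ p ∣ ∣ q ∣)) (s≤s (∣p∪q∣≤∣p∣+∣q∣ p q))
∣p∪q∣≤∣p∣+∣q∣ (inside ∷ p)  (outside ∷ q) = s≤s (∣p∪q∣≤∣p∣+∣q∣ p q)
∣p∪q∣≤∣p∣+∣q∣ (inside ∷ p)  (inside ∷ q)  =
  s≤s (≤-trans (∣p∪q∣≤∣p∣+∣q∣ p q) (subst (∣ p ∣ + ∣ q ∣ ≤_) (sym (+-suc ∣ p ∣ ∣ q ∣)) (n≤1+n _)))

⊆pair⇒∣∣≤2 : ∀ {m} (p : Subset m) (a b : Fin m) → (∀ {x} → x ∈ p → x ≡ a ⊎ x ≡ b) → ∣ p ∣ ≤ 2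
⊆pair⇒∣∣≤2 p a b p⊆ab =
  ≤-trans (p⊆q⇒∣p∣≤∣q∣ p⊆⁅a⁆∪⁅b⁆)
    (≤-trans (∣p∪q∣≤∣p∣+∣q∣ ⁅ a ⁆ ⁅ b ⁆)
             (subst₂ (λ i j → i + j ≤ 2) (sym (∣⁅x⁆∣≡1 a)) (sym (∣⁅x⁆∣≡1 b)) ≤-refl))
  where
  p⊆⁅a⁆∪⁅b⁆ : ∀ {x} → x ∈ p → x ∈ ⁅ a ⁆ ∪ ⁅ b ⁆
  p⊆⁅a⁆∪⁅b⁆ x∈p with p⊆ab x∈p
  ... | inj₁ refl = x∈p∪q⁺ (inj₁ (x∈⁅x⁆ a))
  ... | inj₂ refl = x∈p∪q⁺ (inj₂ (x∈⁅x⁆ b))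

other-index : ∀ {i j k : Fin 2} → j ≢ i → k ≢ i → j ≡ k
other-index {zero}     {zero}                j≢i _   = ⊥-elim (j≢i refl)
other-index {zero}     {suc zero} {zero}     _   k≢i = ⊥-elim (k≢i refl)
other-index {zero}     {suc zero} {suc zero} _   _   = refl
other-index {suc zero} {suc zero}            j≢i _   = ⊥-elim (j≢i refl)
other-index {suc zero} {zero}     {suc zero} _   k≢i = ⊥-elim (k≢i refl)
other-index {suc zero} {zero}     {zero}     _   _   = refl

least-witness : ∀ {P : ℕ → Set} → U.Decidable P → ∀ k → P k →
                ∃ λ m → m ≤ k × P m × (∀ {j} → j < m → ¬ P j)
least-witness {P} P? = <-rec Goal search
  where
  Goal : ℕ → Set
  Goal k = P k → ∃ λ m → m ≤ k × P m × (∀ {j} → j < m → ¬ P j)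
  search : ∀ k → (∀ {j} → j < k → Goal j) → Goal k
  search k below Pk with anyUpTo? P? k
  ... | no none = k , ≤-refl , Pk , λ j<k Pj → none (_ , j<k , Pj)
  ... | yes (j , j<k , Pj) with below j<k Pj
  ...   | m , m≤j , Pm , minimal = m , ≤-trans m≤j (<⇒≤ j<k) , Pm , minimal

module GroupFacts (G : FiniteAbelianGroup) where
  open FiniteAbelianGroup G public

  abelianGroup : AbelianGroup 0ℓ 0ℓ
  abelianGroup = record { isAbelianGroup = isAbelianGroup }

  open AbelianGroup abelianGroup public using (assoc; comm; identityˡ; identityʳ; inverseˡ; inverseʳ)
  open AbelianGroupProperties abelianGroup public
    using ( ∙-cancelˡ; ∙-cancelʳ; inverseʳ-unique; ⁻¹-involutive; ⁻¹-∙-comm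
          ; inverseˡ-unique; \\-leftDividesˡ; //-rightDividesʳ)
  open CommutativeMonoidSolver (AbelianGroup.commutativeMonoid abelianGroup) public
    using (solve; _⊜_; _⊕_)

  x≢a∙x : ∀ {a} x → a ≢ ε → x ≢ a ∙ x
  x≢a∙x {a} x a≢ε x≡ax = a≢ε (sym (∙-cancelʳ x ε a (trans (identityˡ x) x≡ax)))

  x∙[x∙y]⁻¹≡y⁻¹ : ∀ x y → x ∙ (x ∙ y) ⁻¹ ≡ y ⁻¹
  x∙[x∙y]⁻¹≡y⁻¹ x y = trans (cong (x ∙_) (sym (⁻¹-∙-comm x y))) (\\-leftDividesˡ x (y ⁻¹))

  pow-+ : ∀ g a b → pow G g (a + b) ≡ pow G g a ∙ pow G g b
  pow-+ g zero    b = sym (identityˡ _)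
  pow-+ g (suc a) b = trans (cong (g ∙_) (pow-+ g a b)) (sym (assoc _ _ _))

  -- If every order of g is at least b, then no power gᵏ with 0 < k < b is
  -- trivial: the least such k would be an order of g below b.
  small-power≢ε : ∀ {g b} → (∀ m → HasOrder G g m → b ≤ m) → ∀ k → 0 < k → k < b → pow G g k ≢ ε
  small-power≢ε {g} order≥b k 0<k k<b gᵏ≡ε
    with least-witness (λ j → (0 <? j) ×-dec (pow G g j ≟ᶠ ε)) k (0<k , gᵏ≡ε)
  ... | m , m≤k , (0<m , gᵐ≡ε) , minimal =
    <-irrefl refl (≤-trans (s≤s m≤k) (≤-trans k<b (order≥b m hasOrder)))
    where
    hasOrder : HasOrder G g m
    hasOrder = 0<m , gᵐ≡ε , λ j 0<j j<m gʲ≡ε → minimal j<m (0<j , gʲ≡ε)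

module SubgroupFacts (G : FiniteAbelianGroup) (T : Fin (FiniteAbelianGroup.n G) → Set) where
  open GroupFacts G
  open ≡-Reasoning

  ⟨T⟩ : Fin n → Set
  ⟨T⟩ = Generated G T

  ⟨T⟩-divʳ : ∀ {x y} → ⟨T⟩ (x ∙ y) → ⟨T⟩ y → ⟨T⟩ x
  ⟨T⟩-divʳ {x} {y} xy∈ y∈ = subst ⟨T⟩ (//-rightDividesʳ y x) (mul xy∈ (inv y∈))

  ⟨T⟩-divˡ : ∀ {x y} → ⟨T⟩ (x ∙ y) → ⟨T⟩ x → ⟨T⟩ y
  ⟨T⟩-divˡ {x} {y} xy∈ = ⟨T⟩-divʳ (subst ⟨T⟩ (comm x y) xy∈)

  ⟨T⟩-inv⁻¹ : ∀ {x} → ⟨T⟩ (x ⁻¹) → ⟨T⟩ x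
  ⟨T⟩-inv⁻¹ {x} x⁻¹∈ = subst ⟨T⟩ (⁻¹-involutive x) (inv x⁻¹∈)

  index-two : HasIndex G ⟨T⟩ 2 → ∀ {x y} → ¬ ⟨T⟩ x → ¬ ⟨T⟩ y → ⟨T⟩ (x ⁻¹ ∙ y)
  index-two (g , cover , _) {x} {y} x∉ y∉ with cover ε | cover x | cover y
  ... | i , ε∈gᵢ | j , x∈gⱼ | k , y∈gₖ = same-coset x∈gⱼ (subst (λ l → ⟨T⟩ (g l ⁻¹ ∙ y)) (sym j≡k) y∈gₖ)
    where
    trivial-coset : ∀ {a z} → ⟨T⟩ (a ⁻¹ ∙ ε) → ⟨T⟩ (a ⁻¹ ∙ z) → ⟨T⟩ z
    trivial-coset ε∈ z∈ = ⟨T⟩-divˡ z∈ (subst ⟨T⟩ (identityʳ _) ε∈)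
    -- x and y avoid the coset of ε, and only one coset remains.
    j≡k : j ≡ k
    j≡k = other-index {i} {j} {k} (λ { refl → x∉ (trivial-coset ε∈gᵢ x∈gⱼ) })
                                  (λ { refl → y∉ (trivial-coset ε∈gᵢ y∈gₖ) })
    same-coset : ∀ {a} → ⟨T⟩ (a ⁻¹ ∙ x) → ⟨T⟩ (a ⁻¹ ∙ y) → ⟨T⟩ (x ⁻¹ ∙ y)
    same-coset {a} x∈ y∈ = subst ⟨T⟩ (begin
      (a ⁻¹ ∙ x) ⁻¹ ∙ (a ⁻¹ ∙ y)   ≡⟨ cong (_∙ (a ⁻¹ ∙ y)) (sym (⁻¹-∙-comm (a ⁻¹) x)) ⟩
      (a ⁻¹ ⁻¹ ∙ x ⁻¹) ∙ (a ⁻¹ ∙ y) ≡⟨ solve 4 (λ b x′ a′ y′ → (b ⊕ x′) ⊕ (a′ ⊕ y′) ⊜ (x′ ⊕ y′) ⊕ (b ⊕ a′))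
                                             refl (a ⁻¹ ⁻¹) (x ⁻¹) (a ⁻¹) y ⟩
      (x ⁻¹ ∙ y) ∙ (a ⁻¹ ⁻¹ ∙ a ⁻¹) ≡⟨ cong ((x ⁻¹ ∙ y) ∙_) (inverseˡ (a ⁻¹)) ⟩
      (x ⁻¹ ∙ y) ∙ ε               ≡⟨ identityʳ _ ⟩
      x ⁻¹ ∙ y                     ∎) (mul (inv x∈) y∈)

  reachable-⊆ : ∀ {S} → (∀ {x} → x ∈ S → ⟨T⟩ x) → ∀ {y x k} → Walk (Cay G S) y x k → ⟨T⟩ y → ⟨T⟩ x
  reachable-⊆ S⊆ here y∈ = y∈
  reachable-⊆ S⊆ (step (w , w∈S , refl) walk) y∈ = reachable-⊆ S⊆ walk (mul y∈ (S⊆ w∈S))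

mk≅ : ∀ {Γ Δ} (f : V Γ → V Δ) (g : V Δ → V Γ) → (∀ y → f (g y) ≡ y) → (∀ x → g (f x) ≡ x) →
      (∀ y y′ → Adj Δ y y′ ⇔ Adj Γ (g y) (g y′)) → Γ ≅ Δ
mk≅ {Γ} {Δ} f g f∘g g∘f adj⇔ = record
  { bij  = mk↔ₛ′ f g f∘g g∘f
  ; pres = λ x x′ → (λ x~x′ → Equivalence.from (adj⇔ (f x) (f x′)) (back x x′ x~x′))
                  , (λ fx~fx′ → subst₂ (Adj Γ) (g∘f x) (g∘f x′) (Equivalence.to (adj⇔ (f x) (f x′)) fx~fx′))
  }
  where
  back : ∀ x x′ → Adj Γ x x′ → Adj Γ (g (f x)) (g (f x′))
  back x x′ = subst₂ (Adj Γ) (sym (g∘f x)) (sym (g∘f x′))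

≅-trans : ∀ {Γ Δ Θ} → Γ ≅ Δ → Δ ≅ Θ → Γ ≅ Θ
≅-trans φ ψ = record
  { bij  = _≅_.bij ψ ↔-∘ _≅_.bij φ
  ; pres = λ x y → proj₁ (_≅_.pres ψ _ _) ∘ proj₁ (_≅_.pres φ x y)
                 , proj₂ (_≅_.pres φ x y) ∘ proj₂ (_≅_.pres ψ _ _)
  }

-- Counting common neighbours in a distance-regular graph

module CommonNeighbours {Γ : Graph} (dr : DistanceRegular Γ) where
  open DistanceRegular dr

  c₂-lower : ∀ {x y} → Dist Γ x y 2 → ∀ {ws} → Unique ws →
             (∀ {z} → z ∈ₗ ws → Dist Γ x z 1 × Adj Γ y z) → length ws ≤ c 2
  c₂-lower d uniq ws-common with c-reg _ _ 1 d
  ... | zs , _ , |zs|≡c₂ , zs-common =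
    subst (_ ≤_) |zs|≡c₂ (unique⊆⇒length≤ zs uniq (λ z∈ws → proj₁ (zs-common _) (ws-common z∈ws)))

  c₂-upper : ∀ {x y} → Dist Γ x y 2 → ∀ ws →
             (∀ {z} → Dist Γ x z 1 → Adj Γ y z → z ∈ₗ ws) → c 2 ≤ length ws
  c₂-upper d ws ws-cover with c-reg _ _ 1 d
  ... | zs , uniq , |zs|≡c₂ , zs-common =
    subst (_≤ length ws) |zs|≡c₂
      (unique⊆⇒length≤ ws uniq (λ z∈zs → let (dxz , ayz) = proj₂ (zs-common _) z∈zs in ws-cover dxz ayz))

  a₁≡0⇒no-triangle : a 1 ≡ 0 → ∀ {x y z} → Dist Γ x y 1 → Dist Γ x z 1 → ¬ Adj Γ y z
  a₁≡0⇒no-triangle a₁≡0 dxy dxz ayz with a-reg _ _ 1 dxy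
  ... | zs , _ , |zs|≡a₁ , zs-common = nonempty (proj₁ (zs-common _) (dxz , ayz)) (trans |zs|≡a₁ a₁≡0)
    where
    nonempty : ∀ {z zs} → z ∈ₗ zs → length zs ≢ 0
    nonempty (here _)  ()
    nonempty (there _) ()

module CayleyFacts (G : FiniteAbelianGroup) (S : Subset (FiniteAbelianGroup.n G))
  (ε∉S : FiniteAbelianGroup.ε G ∉ S) where
  open GroupFacts G

  dist-1 : ∀ {x} → x ∈ S → Dist (Cay G S) ε x 1
  dist-1 {x} x∈S = step (x , x∈S , sym (identityˡ x)) here , minimal
    where
    minimal : ∀ k → Walk (Cay G S) ε x k → 1 ≤ k
    minimal zero    here = ⊥-elim (ε∉S x∈S)
    minimal (suc k) _    = s≤s z≤n

  dist-1⁻ : ∀ {x} → Dist (Cay G S) ε x 1 → x ∈ S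
  dist-1⁻ (step (w , w∈S , refl) here , _) = subst (_∈ S) (sym (identityˡ w)) w∈S

  dist-2 : ∀ {a b} → a ∈ S → b ∈ S → a ∙ b ≢ ε → a ∙ b ∉ S → Dist (Cay G S) ε (a ∙ b) 2
  dist-2 {a} {b} a∈S b∈S ab≢ε ab∉S =
    step (a , a∈S , sym (identityˡ a)) (step (b , b∈S , refl) here) , minimal
    where
    minimal : ∀ k → Walk (Cay G S) ε (a ∙ b) k → 2 ≤ k
    minimal zero          here                          = ⊥-elim (ab≢ε refl)
    minimal (suc zero)    (step (w , w∈S , ab≡εw) here) =
      ⊥-elim (ab∉S (subst (_∈ S) (trans (sym (identityˡ w)) (sym ab≡εw)) w∈S))
    minimal (suc (suc k)) _                             = s≤s (s≤s z≤n)

Searchable : Set → Set₁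
Searchable A = ∀ {P : A → Set} → U.Decidable P → Dec (∀ x → P x)

searchable-Bool : Searchable Bool
searchable-Bool P? with P? false | P? true
... | yes f | yes t = yes λ { false → f ; true → t }
... | no ¬f | _     = no λ h → ¬f (h false)
... | _     | no ¬t = no λ h → ¬t (h true)

searchable-× : ∀ {A B} → Searchable A → Searchable B → Searchable (A × B)
searchable-× search-A search-B P? with search-A (λ a → search-B (λ b → P? (a , b)))
... | yes h = yes λ (a , b) → h a b
... | no ¬h = no λ h → ¬h (λ a b → h (a , b))

_⇔?_ : ∀ {A B : Set} → Dec A → Dec B → Dec (A ⇔ B)
a? ⇔? b? = map′ (λ (f , g) → mk⇔ f g) (λ e → Equivalence.to e , Equivalence.from e)
                ((a? →-dec b?) ×-dec (b? →-dec a?))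

-- The group ℤ₆ × ℤ₂ of codes, and the Cayley graph of the connection set
-- {(±1,0), (0,1), (2,1), (4,1)}; it is isomorphic to K₆,₆ minus a perfect matching.

Code : Set
Code = Fin 6 × Bool

search-Code : Searchable Code
search-Code = searchable-× all? searchable-Bool

_≟ᶜ_ : (c d : Code) → Dec (c ≡ d)
_≟ᶜ_ = ≡-dec _≟ᶠ_ _≟ᵇ_

_+ᶜ_ : Code → Code → Code
(a , b) +ᶜ (a′ , b′) = fromℕ< (m%n<n (toℕ a + toℕ a′) 6) , b xor b′

-ᶜ_ : Code → Code
-ᶜ (a , b) = fromℕ< (m%n<n (6 ∸ toℕ a) 6) , b

0ᶜ : Code
0ᶜ = zero , false

-- the connection set, listed as (1,0), (5,0), (0,1), (2,1), (4,1)
Sᶜ : List Code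
Sᶜ = (suc zero , false) ∷ (suc (suc (suc (suc (suc zero)))) , false)
   ∷ (zero , true) ∷ (suc (suc zero) , true) ∷ (suc (suc (suc (suc zero))) , true) ∷ []

CodeAdj : Code → Code → Set
CodeAdj c d = Any (λ e → d ≡ c +ᶜ e) Sᶜ

CodeGraph : Graph
CodeGraph = record { V = Code ; Adj = CodeAdj }

+ᶜ-inverseʳ : ∀ c → c +ᶜ (-ᶜ c) ≡ 0ᶜ
+ᶜ-inverseʳ = toWitness {a? = search-Code (λ c → (c +ᶜ (-ᶜ c)) ≟ᶜ 0ᶜ)} _

+ᶜ-inverse-unique : ∀ c d → d +ᶜ (-ᶜ c) ≡ 0ᶜ → d ≡ c
+ᶜ-inverse-unique = toWitness
  {a? = search-Code (λ c → search-Code (λ d → ((d +ᶜ (-ᶜ c)) ≟ᶜ 0ᶜ) →-dec (d ≟ᶜ c)))} _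

-- Relabelling of codes by the vertices (side, index) of K₆,₆ − 6K₂; the codes c
-- and c + (3,0), the only non-neighbours in the opposite part, share an index.
K : Set
K = Bool × Fin 6

to-K : Code → K
to-K (zero , false)                               = false , zero
to-K (suc (suc zero) , false)                     = false , suc zero
to-K (suc (suc (suc (suc zero))) , false)         = false , suc (suc zero)
to-K (suc zero , true)                            = false , suc (suc (suc zero))
to-K (suc (suc (suc zero)) , true)                = false , suc (suc (suc (suc zero)))
to-K (suc (suc (suc (suc (suc zero)))) , true)    = false , suc (suc (suc (suc (suc zero))))
to-K (suc (suc (suc zero)) , false)               = true  , zero
to-K (suc (suc (suc (suc (suc zero)))) , false)   = true  , suc zero
to-K (suc zero , false)                           = true  , suc (suc zero)
to-K (suc (suc (suc (suc zero))) , true)          = true  , suc (suc (suc zero))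
to-K (zero , true)                                = true  , suc (suc (suc (suc zero)))
to-K (suc (suc zero) , true)                      = true  , suc (suc (suc (suc (suc zero))))

from-K : K → Code
from-K (false , zero)                             = zero , false
from-K (false , suc zero)                         = suc (suc zero) , false
from-K (false , suc (suc zero))                   = suc (suc (suc (suc zero))) , false
from-K (false , suc (suc (suc zero)))             = suc zero , true
from-K (false , suc (suc (suc (suc zero))))       = suc (suc (suc zero)) , true
from-K (false , suc (suc (suc (suc (suc zero))))) = suc (suc (suc (suc (suc zero)))) , true
from-K (true , zero)                              = suc (suc (suc zero)) , false
from-K (true , suc zero)                          = suc (suc (suc (suc (suc zero)))) , false
from-K (true , suc (suc zero))                    = suc zero , false
from-K (true , suc (suc (suc zero)))              = suc (suc (suc (suc zero))) , true
from-K (true , suc (suc (suc (suc zero))))        = zero , true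
from-K (true , suc (suc (suc (suc (suc zero)))))  = suc (suc zero) , true

CodeGraph≅K66-6K2 : CodeGraph ≅ K66-6K2
CodeGraph≅K66-6K2 = mk≅ to-K from-K
  (toWitness {a? = search-K (λ k → ≡-dec _≟ᵇ_ _≟ᶠ_ (to-K (from-K k)) k)} _)
  (toWitness {a? = search-Code (λ c → from-K (to-K c) ≟ᶜ c)} _)
  (toWitness {a? = search-K (λ k → search-K (λ l → adjK? k l ⇔? codeAdj? (from-K k) (from-K l)))} _)
  where
  search-K : Searchable K
  search-K = searchable-× searchable-Bool all?
  adjK? : ∀ k l → Dec (Adj K66-6K2 k l)
  adjK? (p , i) (q , j) = ((p xor q) ≟ᵇ true) ×-dec ¬? (i ≟ᶠ j)
  codeAdj? : ∀ c d → Dec (CodeAdj c d)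
  codeAdj? c d = any? (λ e → d ≟ᶜ (c +ᶜ e)) Sᶜ

-- Recognising Cay(G;S) as the Cayley graph of ℤ₆ × ℤ₂

module Embedding (G : FiniteAbelianGroup) (s t : Fin (FiniteAbelianGroup.n G)) where
  open FiniteAbelianGroup G

  t^ : Bool → Fin n
  t^ false = ε
  t^ true  = t

  embed : Code → Fin n
  embed (a , b) = pow G s (toℕ a) ∙ t^ b

module Recognition (G : FiniteAbelianGroup) (S : Subset (FiniteAbelianGroup.n G))
  (s t : Fin (FiniteAbelianGroup.n G))
  (s⁶≡ε : pow G s 6 ≡ FiniteAbelianGroup.ε G)
  (t²≡ε : FiniteAbelianGroup._∙_ G t t ≡ FiniteAbelianGroup.ε G)
  (faithful : ∀ c → Embedding.embed G s t c ≡ FiniteAbelianGroup.ε G → c ≡ 0ᶜ)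
  (S⊆image : ∀ {x} → x ∈ S → Any (λ d → x ≡ Embedding.embed G s t d) Sᶜ)
  (image⊆S : ∀ {d} → d ∈ₗ Sᶜ → Embedding.embed G s t d ∈ S)
  (connected : Connected (Cay G S))
  where
  open GroupFacts G
  open ≡-Reasoning

  open Embedding G s t renaming (embed to φ)

  pow-mod-6 : ∀ m → pow G s m ≡ pow G s (m % 6)
  pow-mod-6 m = begin
    pow G s m                                 ≡⟨ cong (pow G s) (m≡m%n+[m/n]*n m 6) ⟩
    pow G s (m % 6 + (m / 6) * 6)             ≡⟨ pow-+ s (m % 6) _ ⟩
    pow G s (m % 6) ∙ pow G s ((m / 6) * 6)   ≡⟨ cong (pow G s (m % 6) ∙_) (pow-multiple (m / 6)) ⟩
    pow G s (m % 6) ∙ ε                       ≡⟨ identityʳ _ ⟩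
    pow G s (m % 6)                           ∎
    where
    pow-multiple : ∀ q → pow G s (q * 6) ≡ ε
    pow-multiple zero    = refl
    pow-multiple (suc q) = trans (pow-+ s 6 (q * 6)) (trans (cong₂ _∙_ s⁶≡ε (pow-multiple q)) (identityˡ ε))

  φ-hom : ∀ c d → φ c ∙ φ d ≡ φ (c +ᶜ d)
  φ-hom (a , b) (a′ , b′) = begin
    (sᵃ ∙ t^ b) ∙ (sᵃ′ ∙ t^ b′)
      ≡⟨ solve 4 (λ x y z w → (x ⊕ y) ⊕ (z ⊕ w) ⊜ (x ⊕ z) ⊕ (y ⊕ w)) refl sᵃ (t^ b) sᵃ′ (t^ b′) ⟩
    (sᵃ ∙ sᵃ′) ∙ (t^ b ∙ t^ b′)
      ≡⟨ cong₂ _∙_ (sym (pow-+ s (toℕ a) (toℕ a′))) (t^-xor b b′) ⟩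
    pow G s (toℕ a + toℕ a′) ∙ t^ (b xor b′)
      ≡⟨ cong (_∙ t^ (b xor b′)) (trans (pow-mod-6 (toℕ a + toℕ a′)) (cong (pow G s) (sym (toℕ-fromℕ< a+a′%6<6)))) ⟩
    φ ((a , b) +ᶜ (a′ , b′))
      ∎
    where
    sᵃ sᵃ′ : Fin n
    sᵃ = pow G s (toℕ a)
    sᵃ′ = pow G s (toℕ a′)
    a+a′%6<6 : (toℕ a + toℕ a′) % 6 < 6
    a+a′%6<6 = m%n<n (toℕ a + toℕ a′) 6
    t^-xor : ∀ b b′ → t^ b ∙ t^ b′ ≡ t^ (b xor b′)
    t^-xor false b′    = identityˡ _
    t^-xor true  false = identityʳ t
    t^-xor true  true  = t²≡ε

  φ-injective : ∀ c d → φ c ≡ φ d → c ≡ d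
  φ-injective c d φc≡φd = sym (+ᶜ-inverse-unique c d (faithful _ (begin
    φ (d +ᶜ (-ᶜ c))   ≡⟨ sym (φ-hom d (-ᶜ c)) ⟩
    φ d ∙ φ (-ᶜ c)    ≡⟨ cong (_∙ φ (-ᶜ c)) (sym φc≡φd) ⟩
    φ c ∙ φ (-ᶜ c)    ≡⟨ φ-hom c (-ᶜ c) ⟩
    φ (c +ᶜ (-ᶜ c))   ≡⟨ cong φ (+ᶜ-inverseʳ c) ⟩
    φ 0ᶜ              ≡⟨ identityˡ ε ⟩
    ε                 ∎)))

  φ-adj : ∀ c d → CodeAdj c d ⇔ Adj (Cay G S) (φ c) (φ d)
  φ-adj c d = mk⇔ to from
    where
    to : CodeAdj c d → Adj (Cay G S) (φ c) (φ d)
    to adj with find adj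
    ... | e , e∈Sᶜ , d≡c+e = φ e , image⊆S e∈Sᶜ , trans (cong φ d≡c+e) (sym (φ-hom c e))
    from : Adj (Cay G S) (φ c) (φ d) → CodeAdj c d
    from (w , w∈S , φd≡φc∙w) =
      Any.map (λ {e} w≡φe → φ-injective _ _ (trans φd≡φc∙w (trans (cong (φ c ∙_) w≡φe) (φ-hom c e))))
              (S⊆image w∈S)

  -- φ is surjective: walking from ε, every step multiplies by an element of S = φ(Sᶜ).
  φ-surjective : ∀ x → ∃ λ c → x ≡ φ c
  φ-surjective x = along (proj₂ (connected ε x)) (0ᶜ , sym (identityˡ ε))
    where
    along : ∀ {y x k} → Walk (Cay G S) y x k → ∃ (λ c → y ≡ φ c) → ∃ (λ c → x ≡ φ c)
    along here found = found
    along (step (w , w∈S , refl) walk) (c , y≡φc) with find (S⊆image w∈S)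
    ... | e , _ , w≡φe = along walk (c +ᶜ e , trans (cong₂ _∙_ y≡φc w≡φe) (φ-hom c e))

  Cay≅CodeGraph : Cay G S ≅ CodeGraph
  Cay≅CodeGraph = mk≅ decode φ (λ c → φ-injective _ _ (sym (proj₂ (φ-surjective (φ c)))))
                               (λ x → sym (proj₂ (φ-surjective x))) φ-adj
    where
    decode : Fin n → Code
    decode x = proj₁ (φ-surjective x)

module Setting
  (G : FiniteAbelianGroup) (S : Subset (FiniteAbelianGroup.n G))
  (ε∉S : FiniteAbelianGroup.ε G ∉ S)
  (S-inv : ∀ x → x ∈ S → FiniteAbelianGroup._⁻¹ G x ∈ S)
  (|S|≥3 : 3 ≤ ∣ S ∣)
  (s : Fin (FiniteAbelianGroup.n G)) (s∈S : s ∈ S)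
  (H≢G : ¬ (∀ x → Generated G (λ t → t ∈ S × t ≢ s × t ≢ FiniteAbelianGroup._⁻¹ G s) x))
  ([G:H]≡2 : HasIndex G (Generated G (λ t → t ∈ S × t ≢ s × t ≢ FiniteAbelianGroup._⁻¹ G s)) 2)
  (order≥6 : ∀ m → HasOrder G s m → 6 ≤ m)
  (dr : DistanceRegular (Cay G S))
  (a₁≡0 : DistanceRegular.a dr 1 ≡ 0)
  where
  open GroupFacts G
  open CayleyFacts G S ε∉S
  open CommonNeighbours dr
  open DistanceRegular dr using (c; connected)
  open ≡-Reasoning

  T : Fin n → Set
  T x = x ∈ S × x ≢ s × x ≢ s ⁻¹

  open SubgroupFacts G T renaming (⟨T⟩ to H; ⟨T⟩-divʳ to H-divʳ; ⟨T⟩-inv⁻¹ to H-inv⁻¹)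

  infix 4 _~_
  _~_ : Fin n → Fin n → Set
  _~_ = Adj (Cay G S)

  ~-intro : ∀ {x y w} → w ∈ S → x ∙ w ≡ y → x ~ y
  ~-intro w∈S xw≡y = _ , w∈S , sym xw≡y

  r : Fin n
  r = s ∙ s

  S-cases : ∀ {x} → x ∈ S → x ≡ s ⊎ x ≡ s ⁻¹ ⊎ T x
  S-cases {x} x∈S with x ≟ᶠ s | x ≟ᶠ s ⁻¹
  ... | yes x≡s | _         = inj₁ x≡s
  ... | no _    | yes x≡s⁻¹ = inj₂ (inj₁ x≡s⁻¹)
  ... | no x≢s  | no x≢s⁻¹  = inj₂ (inj₂ (x∈S , x≢s , x≢s⁻¹))

  -- s ∉ H, for otherwise S ⊆ H and, Cay(G;S) being connected, H = G.
  s∉H : ¬ H s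
  s∉H s∈H = H≢G (λ x → reachable-⊆ S⊆H (proj₂ (connected ε x)) one)
    where
    S⊆H : ∀ {x} → x ∈ S → H x
    S⊆H x∈S with S-cases x∈S
    ... | inj₁ refl        = s∈H
    ... | inj₂ (inj₁ refl) = inv s∈H
    ... | inj₂ (inj₂ x∈T)  = gen x∈T

  s⁻¹∉H : ¬ H (s ⁻¹)
  s⁻¹∉H = s∉H ∘ H-inv⁻¹

  H-separates : ∀ {x y} → ¬ H x → H y → x ≢ y
  H-separates x∉H y∈H refl = x∉H y∈H

  S∩H⊆T : ∀ {x} → x ∈ S → H x → T x
  S∩H⊆T x∈S x∈H = x∈S , (λ { refl → s∉H x∈H }) , (λ { refl → s⁻¹∉H x∈H })

  T-inv : ∀ {x} → T x → T (x ⁻¹)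
  T-inv {x} x∈T = S∩H⊆T (S-inv x (proj₁ x∈T)) (inv (gen x∈T))

  -- s⁻¹ and s lie in the unique nontrivial coset of H, so r = s² ∈ H.
  r∈H : H r
  r∈H = subst H (cong (_∙ s) (⁻¹-involutive s)) (index-two [G:H]≡2 s⁻¹∉H s∉H)

  sᵏ≢ε : ∀ k → 0 < k → k < 6 → pow G s k ≢ ε
  sᵏ≢ε = small-power≢ε order≥6

  s²≡r : pow G s 2 ≡ r
  s²≡r = cong (s ∙_) (identityʳ s)

  s⁴≡r² : pow G s 4 ≡ r ∙ r
  s⁴≡r² = trans (pow-+ s 2 2) (cong₂ _∙_ s²≡r s²≡r)

  r≢ε : r ≢ ε
  r≢ε r≡ε = sᵏ≢ε 2 (s≤s z≤n) (s≤s (s≤s (s≤s z≤n))) (trans s²≡r r≡ε)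

  r²≢ε : r ∙ r ≢ ε
  r²≢ε r²≡ε = sᵏ≢ε 4 (s≤s z≤n) (s≤s (s≤s (s≤s (s≤s (s≤s z≤n))))) (trans s⁴≡r² r²≡ε)

  s≢s⁻¹ : s ≢ s ⁻¹
  s≢s⁻¹ s≡s⁻¹ = r≢ε (trans (cong (s ∙_) s≡s⁻¹) (inverseʳ s))

  -- a₁ = 0: since r is adjacent to the neighbour s of ε, r is not a neighbour of ε.
  r∉S : r ∉ S
  r∉S r∈S = a₁≡0⇒no-triangle a₁≡0 (dist-1 s∈S) (dist-1 r∈S) (~-intro s∈S refl)

  -- For u ∈ T, the common neighbours of ε and su are s, u, and, when ru ∈ S,
  -- also ru and s⁻¹. Hence c₂ = 2 if ru ∉ S and c₂ = 4 if ru ∈ S.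
  module AtSU {u} (u∈T : T u) where
    u∈S : u ∈ S
    u∈S = proj₁ u∈T

    su∉H : ¬ H (s ∙ u)
    su∉H su∈H = s∉H (H-divʳ su∈H (gen u∈T))

    su∉S : s ∙ u ∉ S
    su∉S su∈S with S-cases su∈S
    ... | inj₁ su≡s          = ε∉S (subst (_∈ S) (∙-cancelˡ s u ε (trans su≡s (sym (identityʳ s)))) u∈S)
    ... | inj₂ (inj₂ su∈T)   = su∉H (gen su∈T)
    ... | inj₂ (inj₁ su≡s⁻¹) = r∉S (subst (_∈ S) (sym (inverseˡ-unique r u (begin
          (s ∙ s) ∙ u   ≡⟨ assoc s s u ⟩
          s ∙ (s ∙ u)   ≡⟨ cong (s ∙_) su≡s⁻¹ ⟩
          s ∙ s ⁻¹      ≡⟨ inverseʳ s ⟩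
          ε             ∎))) (S-inv u u∈S))

    dist-su : Dist (Cay G S) ε (s ∙ u) 2
    dist-su = dist-2 s∈S u∈S (λ su≡ε → proj₂ (proj₂ u∈T) (inverseʳ-unique s u su≡ε)) su∉S

    su∙s⁻¹≡u : (s ∙ u) ∙ s ⁻¹ ≡ u
    su∙s⁻¹≡u = trans (cong (_∙ s ⁻¹) (comm s u)) (//-rightDividesʳ s u)

    su∙s≡ru : (s ∙ u) ∙ s ≡ r ∙ u
    su∙s≡ru = solve 2 (λ s u → (s ⊕ u) ⊕ s ⊜ (s ⊕ s) ⊕ u) refl s u

    su∙w≡s⁻¹ : ∀ {w} → (s ∙ u) ∙ w ≡ s ⁻¹ → w ⁻¹ ≡ r ∙ u
    su∙w≡s⁻¹ {w} su∙w≡s⁻¹ = sym (inverseˡ-unique (r ∙ u) w (begin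
      (r ∙ u) ∙ w         ≡⟨ solve 3 (λ s u w → ((s ⊕ s) ⊕ u) ⊕ w ⊜ s ⊕ ((s ⊕ u) ⊕ w)) refl s u w ⟩
      s ∙ ((s ∙ u) ∙ w)   ≡⟨ cong (s ∙_) su∙w≡s⁻¹ ⟩
      s ∙ s ⁻¹            ≡⟨ inverseʳ s ⟩
      ε                   ∎))

    su~s : s ∙ u ~ s
    su~s = ~-intro (S-inv u u∈S) (//-rightDividesʳ u s)

    su~u : s ∙ u ~ u
    su~u = ~-intro (S-inv s s∈S) su∙s⁻¹≡u

    su~ru : s ∙ u ~ r ∙ u
    su~ru = ~-intro s∈S su∙s≡ru

    su~s⁻¹ : r ∙ u ∈ S → s ∙ u ~ s ⁻¹
    su~s⁻¹ ru∈S = ~-intro (S-inv (r ∙ u) ru∈S) (inverseʳ-unique s ((s ∙ u) ∙ (r ∙ u) ⁻¹) (begin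
      s ∙ ((s ∙ u) ∙ (r ∙ u) ⁻¹)
        ≡⟨ solve 3 (λ s u v → s ⊕ ((s ⊕ u) ⊕ v) ⊜ ((s ⊕ s) ⊕ u) ⊕ v) refl s u ((r ∙ u) ⁻¹) ⟩
      (r ∙ u) ∙ (r ∙ u) ⁻¹
        ≡⟨ inverseʳ (r ∙ u) ⟩
      ε ∎))

    Candidate : Fin n → Set
    Candidate z = z ≡ s ⊎ z ≡ u ⊎ (r ∙ u ∈ S × (z ≡ r ∙ u ⊎ z ≡ s ⁻¹))

    -- A common neighbour z = (su) w: if z ∉ T it is s or s⁻¹, and if z ∈ T then
    -- w ∉ T (else s ∈ H), so w = s or w = s⁻¹.
    common : ∀ {z} → z ∈ S → s ∙ u ~ z → Candidate z
    common {z} z∈S (w , w∈S , z≡su∙w) with S-cases z∈S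
    ... | inj₁ z≡s          = inj₁ z≡s
    ... | inj₂ (inj₁ z≡s⁻¹) =
      inj₂ (inj₂ (subst (_∈ S) (su∙w≡s⁻¹ (trans (sym z≡su∙w) z≡s⁻¹)) (S-inv w w∈S) , inj₂ z≡s⁻¹))
    ... | inj₂ (inj₂ z∈T) with S-cases w∈S
    ...   | inj₁ refl        = inj₂ (inj₂ (subst (_∈ S) z≡ru z∈S , inj₁ z≡ru))
      where
      z≡ru : z ≡ r ∙ u
      z≡ru = trans z≡su∙w su∙s≡ru
    ...   | inj₂ (inj₁ refl) = inj₂ (inj₁ (trans z≡su∙w su∙s⁻¹≡u))
    ...   | inj₂ (inj₂ w∈T)  = ⊥-elim (su∉H (H-divʳ (subst H z≡su∙w (gen z∈T)) (gen w∈T)))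

    s≢u : s ≢ u
    s≢u = H-separates s∉H (gen u∈T)

    c₂≥2 : 2 ≤ c 2
    c₂≥2 = c₂-lower dist-su ((s≢u ∷ []) ∷ [] ∷ [])
      λ { (here refl) → dist-1 s∈S , su~s ; (there (here refl)) → dist-1 u∈S , su~u }

    c₂≥4 : r ∙ u ∈ S → 4 ≤ c 2
    c₂≥4 ru∈S = c₂-lower dist-su
      ( (s≢u ∷ H-separates s∉H ru∈H ∷ s≢s⁻¹ ∷ [])
      ∷ (x≢a∙x u r≢ε ∷ proj₂ (proj₂ u∈T) ∷ [])
      ∷ ((λ ru≡s⁻¹ → H-separates s⁻¹∉H ru∈H (sym ru≡s⁻¹)) ∷ [])
      ∷ [] ∷ [])
      λ { (here refl)                         → dist-1 s∈S , su~s
        ; (there (here refl))                 → dist-1 u∈S , su~u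
        ; (there (there (here refl)))         → dist-1 ru∈S , su~ru
        ; (there (there (there (here refl)))) → dist-1 (S-inv s s∈S) , su~s⁻¹ ru∈S }
      where
      ru∈H : H (r ∙ u)
      ru∈H = mul r∈H (gen u∈T)

    c₂≤2 : r ∙ u ∉ S → c 2 ≤ 2
    c₂≤2 ru∉S = c₂-upper dist-su (s ∷ u ∷ []) λ d su~z → cover (common (dist-1⁻ d) su~z)
      where
      cover : ∀ {z} → Candidate z → z ∈ₗ (s ∷ u ∷ [])
      cover (inj₁ z≡s)               = here z≡s
      cover (inj₂ (inj₁ z≡u))        = there (here z≡u)
      cover (inj₂ (inj₂ (ru∈S , _))) = ⊥-elim (ru∉S ru∈S)

    c₂≤4 : c 2 ≤ 4
    c₂≤4 = c₂-upper dist-su (s ∷ u ∷ r ∙ u ∷ s ⁻¹ ∷ []) λ d su~z → cover (common (dist-1⁻ d) su~z)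
      where
      cover : ∀ {z} → Candidate z → z ∈ₗ (s ∷ u ∷ r ∙ u ∷ s ⁻¹ ∷ [])
      cover (inj₁ z≡s)                      = here z≡s
      cover (inj₂ (inj₁ z≡u))               = there (here z≡u)
      cover (inj₂ (inj₂ (_ , inj₁ z≡ru)))   = there (there (here z≡ru))
      cover (inj₂ (inj₂ (_ , inj₂ z≡s⁻¹))) = there (there (there (here z≡s⁻¹)))

  dist-r : Dist (Cay G S) ε r 2
  dist-r = dist-2 s∈S s∈S r≢ε r∉S

  r~s : r ~ s
  r~s = ~-intro (S-inv s s∈S) (//-rightDividesʳ s s)

  -- s⁻¹ is not a neighbour of r: for w ∈ S, rw = s⁻¹ forces w ∉ H, and w = s
  -- or w = s⁻¹ would give r² = 1 or r = 1.
  r∙S∌s⁻¹ : ∀ {w} → w ∈ S → r ∙ w ≢ s ⁻¹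
  r∙S∌s⁻¹ w∈S rw≡s⁻¹ with S-cases w∈S
  ... | inj₁ refl        = r²≢ε (begin
        r ∙ r             ≡⟨ solve 1 (λ s → (s ⊕ s) ⊕ (s ⊕ s) ⊜ s ⊕ ((s ⊕ s) ⊕ s)) refl s ⟩
        s ∙ (r ∙ s)       ≡⟨ cong (s ∙_) rw≡s⁻¹ ⟩
        s ∙ s ⁻¹          ≡⟨ inverseʳ s ⟩
        ε                 ∎)
  ... | inj₂ (inj₁ refl) = r≢ε (∙-cancelʳ (s ⁻¹) r ε (trans rw≡s⁻¹ (sym (identityˡ (s ⁻¹)))))
  ... | inj₂ (inj₂ w∈T)  = s⁻¹∉H (subst H rw≡s⁻¹ (mul r∈H (gen w∈T)))

  r-common : ∀ {z} → z ∈ S → r ~ z → z ≡ s ⊎ (T z × r ∙ z ⁻¹ ∈ S)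
  r-common {z} z∈S (w , w∈S , z≡rw) with S-cases z∈S
  ... | inj₁ z≡s         = inj₁ z≡s
  ... | inj₂ (inj₂ z∈T)  = inj₂ (z∈T , subst (λ y → r ∙ y ⁻¹ ∈ S) (sym z≡rw)
                                               (subst (_∈ S) (sym (x∙[x∙y]⁻¹≡y⁻¹ r w)) (S-inv w w∈S)))
  ... | inj₂ (inj₁ z≡s⁻¹) = ⊥-elim (r∙S∌s⁻¹ w∈S (trans (sym z≡rw) z≡s⁻¹))

  -- Otherwise c₂ = 2 at su, so by the above
  -- every common neighbour z ≠ s of ε and r would give c₂ = 4 at s z⁻¹; hence s
  -- would be the only common neighbour of ε and r, contradicting c₂ = 2.
  r∙T⊆S : ∀ {u} → T u → r ∙ u ∈ S
  r∙T⊆S {u} u∈T with (r ∙ u) ∈? S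
  ... | yes ru∈S = ru∈S
  ... | no  ru∉S = ⊥-elim (≤⇒≯ (c₂-upper dist-r (s ∷ []) only-s) (AtSU.c₂≥2 u∈T))
    where
    only-s : ∀ {z} → Dist (Cay G S) ε z 1 → r ~ z → z ∈ₗ (s ∷ [])
    only-s d r~z with r-common (dist-1⁻ d) r~z
    ... | inj₁ z≡s = here z≡s
    ... | inj₂ (z∈T , rz⁻¹∈S) =
      ⊥-elim (≤⇒≯ (AtSU.c₂≤2 u∈T ru∉S) (≤-trans (n≤1+n 3) (AtSU.c₂≥4 (T-inv z∈T) rz⁻¹∈S)))

  T-r-closed : ∀ {u} → T u → T (r ∙ u)
  T-r-closed u∈T = S∩H⊆T (r∙T⊆S u∈T) (mul r∈H (gen u∈T))

  r~T : ∀ {z} → T z → r ~ z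
  r~T {z} z∈T =
    ~-intro (S-inv _ (r∙T⊆S (T-inv z∈T))) (trans (x∙[x∙y]⁻¹≡y⁻¹ r (z ⁻¹)) (⁻¹-involutive z))

  T-inhabited : ∃ T
  T-inhabited with Fin.any? (λ x → (x ∈? S) ×-dec ¬? (x ≟ᶠ s) ×-dec ¬? (x ≟ᶠ s ⁻¹))
  ... | yes found = found
  ... | no  none  = ⊥-elim (≤⇒≯ (⊆pair⇒∣∣≤2 S s (s ⁻¹) S⊆pair) |S|≥3)
    where
    S⊆pair : ∀ {x} → x ∈ S → x ≡ s ⊎ x ≡ s ⁻¹
    S⊆pair x∈S with S-cases x∈S
    ... | inj₁ x≡s          = inj₁ x≡s
    ... | inj₂ (inj₁ x≡s⁻¹) = inj₂ x≡s⁻¹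
    ... | inj₂ (inj₂ x∈T)   = ⊥-elim (none (_ , x∈T))

  u₀ : Fin n
  u₀ = proj₁ T-inhabited

  u₀∈T : T u₀
  u₀∈T = proj₂ T-inhabited

  -- T consists of the three elements t, rt, r²t, for any t ∈ T: otherwise ε and r
  -- would have the five common neighbours s, t, rt, r²t, u, while c₂ ≤ 4.
  T-orbit : ∀ {t u} → T t → T u → u ≡ t ⊎ u ≡ r ∙ t ⊎ u ≡ r ∙ (r ∙ t)
  T-orbit {t} {u} t∈T u∈T with u ≟ᶠ t | u ≟ᶠ r ∙ t | u ≟ᶠ r ∙ (r ∙ t)
  ... | yes u≡t | _        | _          = inj₁ u≡t
  ... | no _    | yes u≡rt | _          = inj₂ (inj₁ u≡rt)
  ... | no _    | no _     | yes u≡r²t  = inj₂ (inj₂ u≡r²t)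
  ... | no u≢t  | no u≢rt  | no u≢r²t   = ⊥-elim (≤⇒≯ (AtSU.c₂≤4 u₀∈T) c₂≥5)
    where
    rt∈T : T (r ∙ t)
    rt∈T = T-r-closed t∈T
    r²t∈T : T (r ∙ (r ∙ t))
    r²t∈T = T-r-closed rt∈T
    s≢ : ∀ {x} → T x → s ≢ x
    s≢ x∈T = H-separates s∉H (gen x∈T)
    t≢r²t : t ≢ r ∙ (r ∙ t)
    t≢r²t t≡r²t = x≢a∙x t r²≢ε (trans t≡r²t (sym (assoc r r t)))
    c₂≥5 : 5 ≤ c 2
    c₂≥5 = c₂-lower dist-r
      ( (s≢ t∈T ∷ s≢ rt∈T ∷ s≢ r²t∈T ∷ s≢ u∈T ∷ [])
      ∷ (x≢a∙x t r≢ε ∷ t≢r²t ∷ (u≢t ∘ sym) ∷ [])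
      ∷ (x≢a∙x (r ∙ t) r≢ε ∷ (u≢rt ∘ sym) ∷ [])
      ∷ ((u≢r²t ∘ sym) ∷ [])
      ∷ [] ∷ [])
      λ { (here refl)                                 → dist-1 s∈S , r~s
        ; (there (here refl))                         → dist-1 (proj₁ t∈T) , r~T t∈T
        ; (there (there (here refl)))                 → dist-1 (proj₁ rt∈T) , r~T rt∈T
        ; (there (there (there (here refl))))         → dist-1 (proj₁ r²t∈T) , r~T r²t∈T
        ; (there (there (there (there (here refl))))) → dist-1 (proj₁ u∈T) , r~T u∈T }

  -- r³ = 1, since r³u₀ ∈ T is one of u₀, ru₀, r²u₀.
  r³≡ε : r ∙ (r ∙ r) ≡ ε
  r³≡ε with T-orbit u₀∈T (T-r-closed (T-r-closed (T-r-closed u₀∈T)))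
  ... | inj₁ r³u₀≡u₀ = ∙-cancelʳ u₀ _ ε (begin
        (r ∙ (r ∙ r)) ∙ u₀    ≡⟨ solve 2 (λ r u → (r ⊕ (r ⊕ r)) ⊕ u ⊜ r ⊕ (r ⊕ (r ⊕ u))) refl r u₀ ⟩
        r ∙ (r ∙ (r ∙ u₀))    ≡⟨ r³u₀≡u₀ ⟩
        u₀                    ≡⟨ identityˡ u₀ ⟨
        ε ∙ u₀                ∎)
  ... | inj₂ (inj₁ r³u₀≡ru₀) = ⊥-elim (x≢a∙x u₀ r²≢ε (sym (trans (assoc r r u₀) (∙-cancelˡ r _ _ r³u₀≡ru₀))))
  ... | inj₂ (inj₂ r³u₀≡r²u₀) = ⊥-elim (x≢a∙x u₀ r≢ε (sym (∙-cancelˡ r _ _ (∙-cancelˡ r _ _ r³u₀≡r²u₀))))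

  s⁶≡ε : pow G s 6 ≡ ε
  s⁶≡ε = trans (pow-+ s 2 4) (trans (cong₂ _∙_ s²≡r s⁴≡r²) r³≡ε)

  -- T contains an involution t: u₀⁻¹ ∈ T is one of u₀, ru₀, r²u₀.
  involution : ∃ λ t → T t × t ∙ t ≡ ε
  involution with T-orbit u₀∈T (T-inv u₀∈T)
  ... | inj₁ u₀⁻¹≡u₀ = u₀ , u₀∈T , trans (cong (u₀ ∙_) (sym u₀⁻¹≡u₀)) (inverseʳ u₀)
  ... | inj₂ (inj₁ u₀⁻¹≡ru₀) = r ∙ (r ∙ u₀) , T-r-closed (T-r-closed u₀∈T) , (begin
        (r ∙ (r ∙ u₀)) ∙ (r ∙ (r ∙ u₀))
          ≡⟨ solve 2 (λ r u → (r ⊕ (r ⊕ u)) ⊕ (r ⊕ (r ⊕ u)) ⊜ (r ⊕ (r ⊕ r)) ⊕ (u ⊕ (r ⊕ u))) refl r u₀ ⟩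
        (r ∙ (r ∙ r)) ∙ (u₀ ∙ (r ∙ u₀))
          ≡⟨ cong₂ _∙_ r³≡ε (trans (cong (u₀ ∙_) (sym u₀⁻¹≡ru₀)) (inverseʳ u₀)) ⟩
        ε ∙ ε
          ≡⟨ identityˡ ε ⟩
        ε ∎)
  ... | inj₂ (inj₂ u₀⁻¹≡r²u₀) = r ∙ u₀ , T-r-closed u₀∈T , (begin
        (r ∙ u₀) ∙ (r ∙ u₀)   ≡⟨ solve 2 (λ r u → (r ⊕ u) ⊕ (r ⊕ u) ⊜ u ⊕ (r ⊕ (r ⊕ u))) refl r u₀ ⟩
        u₀ ∙ (r ∙ (r ∙ u₀))   ≡⟨ cong (u₀ ∙_) (sym u₀⁻¹≡r²u₀) ⟩
        u₀ ∙ u₀ ⁻¹            ≡⟨ inverseʳ u₀ ⟩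
        ε                     ∎)

  t : Fin n
  t = proj₁ involution

  t∈T : T t
  t∈T = proj₁ (proj₂ involution)

  t²≡ε : t ∙ t ≡ ε
  t²≡ε = proj₂ (proj₂ involution)

  open Embedding G s t using (embed)

  embed-s : embed (suc zero , false) ≡ s
  embed-s = trans (identityʳ _) (identityʳ s)

  embed-s⁻¹ : embed (suc (suc (suc (suc (suc zero)))) , false) ≡ s ⁻¹
  embed-s⁻¹ = trans (identityʳ _) (inverseʳ-unique s (pow G s 5) s⁶≡ε)

  embed-t : embed (zero , true) ≡ t
  embed-t = identityˡ t

  embed-rt : embed (suc (suc zero) , true) ≡ r ∙ t
  embed-rt = cong (_∙ t) s²≡r

  embed-r²t : embed (suc (suc (suc (suc zero))) , true) ≡ r ∙ (r ∙ t)
  embed-r²t = trans (cong (_∙ t) s⁴≡r²) (assoc r r t)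

  S⊆image : ∀ {x} → x ∈ S → Any (λ d → x ≡ embed d) Sᶜ
  S⊆image x∈S with S-cases x∈S
  ... | inj₁ refl        = here (sym embed-s)
  ... | inj₂ (inj₁ refl) = there (here (sym embed-s⁻¹))
  ... | inj₂ (inj₂ x∈T) with T-orbit t∈T x∈T
  ...   | inj₁ refl        = there (there (here (sym embed-t)))
  ...   | inj₂ (inj₁ refl) = there (there (there (here (sym embed-rt))))
  ...   | inj₂ (inj₂ refl) = there (there (there (there (here (sym embed-r²t)))))

  image⊆S : ∀ {d} → d ∈ₗ Sᶜ → embed d ∈ S
  image⊆S (here refl)                                 = subst (_∈ S) (sym embed-s) s∈S
  image⊆S (there (here refl))                         = subst (_∈ S) (sym embed-s⁻¹) (S-inv s s∈S)
  image⊆S (there (there (here refl)))                 = subst (_∈ S) (sym embed-t) (proj₁ t∈T)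
  image⊆S (there (there (there (here refl))))         = subst (_∈ S) (sym embed-rt) (proj₁ (T-r-closed t∈T))
  image⊆S (there (there (there (there (here refl))))) =
    subst (_∈ S) (sym embed-r²t) (proj₁ (T-r-closed (T-r-closed t∈T)))

  odd-power∉H : ∀ k → H (pow G s k) → ¬ H (pow G s (suc k))
  odd-power∉H k sᵏ∈H sᵏ⁺¹∈H = s∉H (H-divʳ sᵏ⁺¹∈H sᵏ∈H)

  -- t⁻¹ ∉ ⟨s⟩: an element sᵃ = t⁻¹ would lie in S ∩ H, which no power of s
  -- does (s⁰ = 1 ∉ S, s² = r ∉ S, s⁴ = r⁻¹ ∉ S, odd powers ∉ H).
  sᵃ≢t⁻¹ : ∀ (a : Fin 6) → pow G s (toℕ a) ≢ t ⁻¹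
  sᵃ≢t⁻¹ a sᵃ≡t⁻¹ = excluded a (subst (_∈ S) (sym sᵃ≡t⁻¹) (S-inv t (proj₁ t∈T)))
                               (subst H (sym sᵃ≡t⁻¹) (inv (gen t∈T)))
    where
    s²∈H : H (pow G s 2)
    s²∈H = subst H (sym s²≡r) r∈H
    s⁴∈H : H (pow G s 4)
    s⁴∈H = subst H (sym s⁴≡r²) (mul r∈H r∈H)
    r≡[r²]⁻¹ : r ≡ (r ∙ r) ⁻¹
    r≡[r²]⁻¹ = inverseʳ-unique (r ∙ r) r (trans (assoc r r r) r³≡ε)
    excluded : ∀ (a : Fin 6) → pow G s (toℕ a) ∈ S → H (pow G s (toℕ a)) → ⊥
    excluded zero                                 s⁰∈S _    = ε∉S s⁰∈S
    excluded (suc zero)                           _    s¹∈H = odd-power∉H 0 one s¹∈H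
    excluded (suc (suc zero))                     s²∈S _    = r∉S (subst (_∈ S) s²≡r s²∈S)
    excluded (suc (suc (suc zero)))               _    s³∈H = odd-power∉H 2 s²∈H s³∈H
    excluded (suc (suc (suc (suc zero))))         s⁴∈S _    =
      r∉S (subst (_∈ S) (sym r≡[r²]⁻¹) (S-inv _ (subst (_∈ S) s⁴≡r² s⁴∈S)))
    excluded (suc (suc (suc (suc (suc zero)))))   _    s⁵∈H = odd-power∉H 4 s⁴∈H s⁵∈H

  faithful : ∀ c → embed c ≡ ε → c ≡ 0ᶜ
  faithful (zero , false)  _       = refl
  faithful (suc a , false) sᵃ∙ε≡ε =
    ⊥-elim (sᵏ≢ε (toℕ (suc a)) (s≤s z≤n) (Fin.toℕ<n (suc a)) (trans (sym (identityʳ _)) sᵃ∙ε≡ε))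
  faithful (a , true)      sᵃt≡ε  = ⊥-elim (sᵃ≢t⁻¹ a (inverseˡ-unique _ t sᵃt≡ε))

proposition6p2 : (G : FiniteAbelianGroup) (S : Subset (FiniteAbelianGroup.n G)) →
    FiniteAbelianGroup.ε G ∉ S →
    (∀ x → x ∈ S → FiniteAbelianGroup._⁻¹ G x ∈ S) →
    3 ≤ ∣ S ∣ →
    (s : Fin (FiniteAbelianGroup.n G)) → s ∈ S →
    ¬ (∀ x → Generated G (λ t → t ∈ S × t ≢ s × t ≢ FiniteAbelianGroup._⁻¹ G s) x) →
    HasIndex G (Generated G (λ t → t ∈ S × t ≢ s × t ≢ FiniteAbelianGroup._⁻¹ G s)) 2 →
    (∀ m → HasOrder G s m → 6 ≤ m) →
    (dr : DistanceRegular (Cay G S)) →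
    DistanceRegular.a dr 1 ≡ 0 →
    Cay G S ≅ K66-6K2
proposition6p2 G S ε∉S S-inv |S|≥3 s s∈S H≢G [G:H]≡2 order≥6 dr a₁≡0 =
  ≅-trans Cay≅CodeGraph CodeGraph≅K66-6K2
  where
  open Setting G S ε∉S S-inv |S|≥3 s s∈S H≢G [G:H]≡2 order≥6 dr a₁≡0
  open Recognition G S s t s⁶≡ε t²≡ε faithful S⊆image image⊆S (DistanceRegular.connected dr)
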